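{- For every positive integer $k$, $$3\left\lceil \frac{3}{4}k\right\rceil -2\le m_{\mathcal{A}^+}(k)\le 4k-3.$$
   Context: The family $\mathcal{A}^+$ consists of hypergraphs $H=(V,E)$ with $V\subset\mathbb{R}^2$ finite and every edge of the form $V\cap\big(\{(x,y): y_0<y<y_1\}\cup\{(x,y): x_0<x<x_1\}\big)$ for some reals $x_0,x_1,y_0,y_1$ (union of a horizontal and a vertical strip). A polychromatic $k$-coloring of a hypergraph is a coloring of its vertices with $k$ colors such that every edge contains a vertex of each color. $H_{\ge m}$ is obtained from $H$ by deleting all edges of size less than $m$. For a hypergraph family $\mathcal{H}$, $m_{\mathcal{H}}(k)$ is the smallest positive integer $m$ such that $H_{\ge m}$ has a polychromatic $k$-coloring for every $H\in\mathcal{H}$ ($\infty$ if none exists).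
   Formalization: The vertices of each hypergraph in $\mathcal{A}^+$ have rational coordinates and the strip parameters $x_0,x_1,y_0,y_1$ are rational, rather than real. -}

module Defs where

open import Data.Nat as ℕ using (ℕ; _/_; _*_; _+_)
open import Data.Fin using (Fin)
open import Data.Rational using (ℚ; _<_)
open import Data.Rational.Properties using (_<?_)
open import Data.Product using (_×_; _,_; Σ; ∃)
open import Data.Sum using (_⊎_)
open import Data.List using (List; length; filter)
open import Data.List.Membership.Propositional using (_∈_)
open import Data.List.Relation.Unary.Unique.Propositional using (Unique)
open import Relation.Binary.PropositionalEquality using (_≡_)
open import Relation.Nullary using (Dec)
open import Relation.Nullary.Decidable using (_×-dec_; _⊎-dec_)

Point : Set
Point = ℚ × ℚ

-- Parameters (x₀, x₁, y₀, y₁) of a union of a horizontal and a vertical strip.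
record Cross : Set where
  constructor cross
  field
    x₀ x₁ y₀ y₁ : ℚ

InCross : Cross → Point → Set
InCross (cross x₀ x₁ y₀ y₁) (x , y) = (y₀ < y × y < y₁) ⊎ (x₀ < x × x < x₁)

inCross? : (s : Cross) → (p : Point) → Dec (InCross s p)
inCross? (cross x₀ x₁ y₀ y₁) (x , y) = (y₀ <? y ×-dec y <? y₁) ⊎-dec (x₀ <? x ×-dec x <? x₁)

-- A hypergraph in the family A⁺: a finite vertex set V ⊂ ℝ² (a duplicate-free list)
-- and an arbitrary set of edges, each edge being V ∩ (cross with parameters s)
-- for some s satisfying the predicate E.
record HypA⁺ : Set₁ where
  field
    V        : List Point
    distinct : Unique V
    E        : Cross → Set

edgeSize : List Point → Cross → ℕ
edgeSize V s = length (filter (inCross? s) V)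

PolychromaticGE : (k m : ℕ) → HypA⁺ → Set
PolychromaticGE k m H =
  Σ (Point → Fin k) λ c →
    ∀ s → HypA⁺.E H s → m ℕ.≤ edgeSize (HypA⁺.V H) s →
      ∀ (j : Fin k) → ∃ λ v → v ∈ HypA⁺.V H × InCross s v × c v ≡ j

-- m is admissible: H_{≥ m} is polychromatically k-colourable for every H ∈ A⁺.
-- m_{A⁺}(k) is the least positive admissible m.
Good : (k m : ℕ) → Set₁
Good k m = (H : HypA⁺) → PolychromaticGE k m H

ceil/4 : ℕ → ℕ
ceil/4 a = (a + 3) / 4

{-# OPTIONS --safe #-}
-- Sort the points by x and by y and cut both orders into blocks of
-- k consecutive points. Every point joins its x-block to its y-block, so the
-- points are the edges of a bipartite multigraph of maximum degree k; by König's
-- edge-colouring theorem they can be coloured so that each full block is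
-- rainbow. An edge of size at least 4k − 3 has 2k − 1 points in its horizontal
-- or in its vertical strip, and 2k − 1 consecutive points of a sorted order
-- contain a full block.
--
-- Let g = ⌈3k/4⌉ − 1 and place eight clusters of g points so that
-- any three clusters are cut out exactly by a cross. Under a k-colouring each
-- cluster misses at least k − g colours, and 8(k − g) > 2k, so some colour is
-- missed by three clusters: the cross around them has 3g points but lacks it.
module Submission where

open import Defs
open import Data.Bool using (true; false; if_then_else_)
open import Data.Empty using (⊥; ⊥-elim)
open import Data.Fin as Fin using (Fin; toℕ)
import Data.Fin.Properties as Fin
open import Data.Fin.Permutation using (Permutation; transpose; _⟨$⟩ʳ_; _⟨$⟩ˡ_; inverseˡ)
import Data.Integer as ℤ
import Data.Integer.Properties as ℤ
open import Data.List using (List; []; _∷_; [_]; _++_; length; filter; map; concat; take; drop; upTo; allFin; tabulate)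
open import Data.List.Properties
  using ( length-removeAt′; length-tabulate; length-filter; length-map; length-take; length-drop; length-++
        ; length-upTo; filter-accept; filter-++; filter-none; filter-notAll; drop-drop; take++drop≡id )
open import Data.List.Membership.Propositional using (_∈_; _∉_; find; lose)
open import Data.List.Membership.Propositional.Properties
  using (∈-allFin; ∈-filter⁺; ∈-filter⁻; ∈-map⁺; ∈-map⁻; ∈-++⁻; ∈-upTo⁺; ∈-upTo⁻
        ; ∈-concat⁺′; ∈-concat⁻′)
import Data.List.Membership.DecPropositional as DecMembership
open import Data.List.Relation.Binary.Disjoint.Propositional using (Disjoint)
open import Data.List.Relation.Binary.Permutation.Propositional using (_↭_; ↭-sym; ↭⇒↭ₛ)
open import Data.List.Relation.Binary.Permutation.Propositional.Properties using (∈-resp-↭; filter-↭; ↭-length)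
import Data.List.Relation.Binary.Permutation.Setoid.Properties as PermutationSetoid
import Data.List.Relation.Binary.Sublist.Propositional as Sublist
import Data.List.Relation.Binary.Sublist.Propositional.Properties as Sublist
open import Data.List.Relation.Binary.Subset.Propositional using (_⊆_)
open import Data.List.Relation.Unary.All as All using (All; []; _∷_; all?)
open import Data.List.Relation.Unary.All.Properties as All using (¬Any⇒All¬; ¬All⇒Any¬)
open import Data.List.Relation.Unary.AllPairs as AllPairs using (AllPairs)
import Data.List.Relation.Unary.AllPairs.Properties as AllPairs
open import Data.List.Relation.Unary.Any using (here; there; index; any?; _─_)
open import Data.List.Relation.Unary.Sorted.TotalOrder.Properties using (Sorted⇒AllPairs)
open import Data.List.Relation.Unary.Unique.Propositional using (Unique; []; _∷_)
open import Data.List.Relation.Unary.Unique.Propositional.Properties as Unique using (Unique[x∷xs]⇒x∉xs)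
import Data.List.Sort as Sort
open import Data.Maybe using (Maybe; just; nothing; _<∣>_; fromMaybe)
open import Data.Nat as ℕ using (ℕ; zero; suc; _+_; _*_; _∸_; _≤_; _<_; _≡ᵇ_; z≤n; s≤s)
open import Data.Nat.Properties as ℕ using (≤-refl; ≤-trans; module ≤-Reasoning)
import Data.Nat.Coprimality as Coprime
open import Data.Nat.DivMod using (m/n*n≤m)
open import Data.Nat.Solver using (module +-*-Solver)
open import Data.Product using (_×_; _,_; ∃; proj₁; proj₂)
open import Data.Product.Properties using (≡-dec)
open import Data.Rational as ℚ using (ℚ; mkℚ; *<*)
import Data.Rational.Properties as ℚ
open import Data.Sum as Sum using (_⊎_; inj₁; inj₂)
open import Data.Unit using (⊤; tt)
open import Data.Vec as Vec using (_∷_; [])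
open import Data.Vec.Functional using (Vector)
open import Function using (_∘_; id)
open import Relation.Binary using (DecidableEquality; DecTotalOrder)
import Relation.Binary.Construct.On as On
open import Relation.Binary.PropositionalEquality
  using (_≡_; _≢_; refl; sym; trans; cong; cong₂; subst; subst₂; setoid)
open import Relation.Nullary using (Dec; yes; no; ¬_; ¬?; does)
open import Relation.Nullary.Decidable using (_×-dec_; _⊎-dec_; _→-dec_; toWitness; dec-true; dec-false)
open import Relation.Unary using (Decidable)
open import Algebra.Properties.CommutativeMonoid.Sum ℕ.+-0-commutativeMonoid
  using (sum; sum-syntax; ∑-comm; ∑-distrib-+; sum-cong-≗)

-- Lists and finite sums

module _ {A : Set} where

  ∈-─⁻ : ∀ {x y : A} {xs} (x∈xs : x ∈ xs) → y ∈ xs → y ≡ x ⊎ y ∈ (xs ─ x∈xs)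
  ∈-─⁻ (here refl) (here refl) = inj₁ refl
  ∈-─⁻ (here refl) (there y∈xs) = inj₂ y∈xs
  ∈-─⁻ (there x∈xs) (here refl) = inj₂ (here refl)
  ∈-─⁻ (there x∈xs) (there y∈xs) = Sum.map₂ there (∈-─⁻ x∈xs y∈xs)

  ─-⊆ : ∀ {x : A} {xs} (x∈xs : x ∈ xs) → (xs ─ x∈xs) ⊆ xs
  ─-⊆ (here refl) y∈ = there y∈
  ─-⊆ (there x∈xs) (here refl) = here refl
  ─-⊆ (there x∈xs) (there y∈) = there (─-⊆ x∈xs y∈)

  length-─ : ∀ {x : A} {xs} (x∈xs : x ∈ xs) → length xs ≡ suc (length (xs ─ x∈xs))
  length-─ {xs = xs} x∈xs = length-removeAt′ xs (index x∈xs)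

  Unique⇒length≤ : ∀ {xs ys : List A} → Unique xs → xs ⊆ ys → length xs ≤ length ys
  Unique⇒length≤ {[]} [] _ = z≤n
  Unique⇒length≤ {x ∷ xs} {ys} (x≢xs ∷ xs-unique) xs⊆ys = begin
    suc (length xs)          ≤⟨ s≤s (Unique⇒length≤ xs-unique xs⊆ys─x) ⟩
    suc (length (ys ─ x∈ys)) ≡⟨ sym (length-─ x∈ys) ⟩
    length ys                ∎
    where
    open ≤-Reasoning
    x∈ys = xs⊆ys (here refl)
    xs⊆ys─x : xs ⊆ (ys ─ x∈ys)
    xs⊆ys─x {y} y∈xs with ∈-─⁻ x∈ys (xs⊆ys (there y∈xs))
    ... | inj₁ refl = ⊥-elim (All.lookup x≢xs y∈xs refl)
    ... | inj₂ y∈ys─x = y∈ys─x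

  take-⊆ : ∀ m (xs : List A) → take m xs ⊆ xs
  take-⊆ m xs = Sublist.lookup (Sublist.take-⊆ m xs)

  drop-⊆ : ∀ m (xs : List A) → drop m xs ⊆ xs
  drop-⊆ m xs = Sublist.lookup (Sublist.drop-⊆ m xs)

  take-drop-disjoint : ∀ m {xs : List A} {x} → Unique xs → x ∈ take m xs → x ∉ drop m xs
  take-drop-disjoint (suc m) {_ ∷ xs} (x≢xs ∷ _) (here refl) x∈drop = All.lookup x≢xs (drop-⊆ m xs x∈drop) refl
  take-drop-disjoint (suc m) {_ ∷ xs} (_ ∷ xs-unique) (there x∈take) = take-drop-disjoint m xs-unique x∈take

  AllPairs-take-drop : ∀ {R : A → A → Set} m {xs x y} → AllPairs R xs → x ∈ take m xs → y ∈ drop m xs → R x y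
  AllPairs-take-drop (suc m) {_ ∷ xs} (Rx ∷ _) (here refl) y∈drop = All.lookup Rx (drop-⊆ m xs y∈drop)
  AllPairs-take-drop (suc m) {_ ∷ xs} (_ ∷ R-xs) (there x∈take) y∈drop = AllPairs-take-drop m R-xs x∈take y∈drop

  length-filter-∷ : ∀ {P : A → Set} (P? : Decidable P) x xs → length (filter P? xs) ≤ length (filter P? (x ∷ xs))
  length-filter-∷ P? x xs with does (P? x)
  ... | true = ℕ.n≤1+n _
  ... | false = ≤-refl

module _ {A B : Set} {f : A → B} where

  Unique-map⁺ : ∀ {xs} → (∀ {x y} → x ∈ xs → y ∈ xs → f x ≡ f y → x ≡ y) →
                Unique xs → Unique (map f xs)
  Unique-map⁺ {[]} _ [] = []
  Unique-map⁺ {x ∷ xs} f-injective (x≢xs ∷ xs-unique) =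
    All.map⁺ (All.tabulate λ y∈xs fx≡fy → All.lookup x≢xs y∈xs (f-injective (here refl) (there y∈xs) fx≡fy))
    ∷ Unique-map⁺ (λ x∈xs y∈xs → f-injective (there x∈xs) (there y∈xs)) xs-unique

module _ {A : Set} {P Q : A → Set} (P? : Decidable P) (Q? : Decidable Q) where

  length-filter-⊎ : ∀ xs →
    length (filter (λ x → P? x ⊎-dec Q? x) xs) ≤ length (filter P? xs) + length (filter Q? xs)
  length-filter-⊎ [] = z≤n
  length-filter-⊎ (x ∷ xs) with P? x | Q? x
  ... | yes _ | yes _ = s≤s (≤-trans (length-filter-⊎ xs) (ℕ.+-monoʳ-≤ _ (ℕ.n≤1+n _)))
  ... | yes _ | no _ = s≤s (length-filter-⊎ xs)
  ... | no _ | yes _ = ≤-trans (s≤s (length-filter-⊎ xs)) (ℕ.≤-reflexive (sym (ℕ.+-suc _ _)))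
  ... | no _ | no _ = length-filter-⊎ xs

length-allFin : ∀ n → length (allFin n) ≡ n
length-allFin n = length-tabulate {n = n} id

length<⇒∃∉ : ∀ {k} (cs : List (Fin k)) → length cs < k → ∃ λ c → c ∉ cs
length<⇒∃∉ {k} cs short = Fin.¬∀⟶∃¬ k (_∈ cs) (λ c → DecMembership._∈?_ Fin._≟_ c cs) λ all∈ →
  ℕ.<-irrefl refl (ℕ.<-≤-trans short (subst (_≤ length cs) (length-allFin k)
    (Unique⇒length≤ (Unique.allFin⁺ k) (λ {c} _ → all∈ c))))

Unique∧length≡⇒∈ : ∀ {k} (cs : List (Fin k)) → Unique cs → length cs ≡ k → ∀ c → c ∈ cs
Unique∧length≡⇒∈ {k} cs cs-unique length≡k c with DecMembership._∈?_ Fin._≟_ c cs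
... | yes c∈cs = c∈cs
... | no c∉cs = ⊥-elim (ℕ.<-irrefl refl (begin-strict
  length (allFin k ─ c∈all)       <⟨ ℕ.n<1+n _ ⟩
  suc (length (allFin k ─ c∈all)) ≡⟨ sym (length-─ c∈all) ⟩
  length (allFin k)               ≡⟨ length-allFin k ⟩
  k                               ≡⟨ sym length≡k ⟩
  length cs                       ≤⟨ Unique⇒length≤ cs-unique cs⊆all─c ⟩
  length (allFin k ─ c∈all)       ∎))
  where
  open ≤-Reasoning
  c∈all = ∈-allFin c
  cs⊆all─c : cs ⊆ (allFin k ─ c∈all)
  cs⊆all─c {d} d∈cs with ∈-─⁻ c∈all (∈-allFin d)
  ... | inj₁ refl = ⊥-elim (c∉cs d∈cs)
  ... | inj₂ d∈all─c = d∈all─c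

Distinct : ∀ {A : Set} → A → A → A → Set
Distinct a b c = a ≢ b × a ≢ c × b ≢ c

𝟙 : ∀ {P : Set} → Dec P → ℕ
𝟙 (yes _) = 1
𝟙 (no _) = 0

𝟙+𝟙¬≡1 : ∀ {P : Set} (d : Dec P) → 𝟙 d + 𝟙 (¬? d) ≡ 1
𝟙+𝟙¬≡1 (yes _) = refl
𝟙+𝟙¬≡1 (no _) = refl

length-filter-tabulate : ∀ {A : Set} {P : A → Set} (P? : Decidable P) {n} (f : Fin n → A) →
                         length (filter P? (tabulate f)) ≡ ∑[ i < n ] 𝟙 (P? (f i))
length-filter-tabulate P? {zero} f = refl
length-filter-tabulate P? {suc n} f with P? (f Fin.zero)
... | yes _ = cong suc (length-filter-tabulate P? (f ∘ Fin.suc))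
... | no _ = length-filter-tabulate P? (f ∘ Fin.suc)

sum-mono-≤ : ∀ {n} {f h : Vector ℕ n} → (∀ i → f i ≤ h i) → sum f ≤ sum h
sum-mono-≤ {zero} _ = z≤n
sum-mono-≤ {suc n} f≤h = ℕ.+-mono-≤ (f≤h Fin.zero) (sum-mono-≤ (f≤h ∘ Fin.suc))

sum-const : ∀ n c → ∑[ i < n ] c ≡ n * c
sum-const zero c = refl
sum-const (suc n) c = cong (c +_) (sum-const n c)

three-distinct : ∀ {A : Set} {xs : List A} → Unique xs → 3 ≤ length xs →
                 ∃ λ a → ∃ λ b → ∃ λ c → Distinct a b c × a ∈ xs × b ∈ xs × c ∈ xs
three-distinct {xs = []} _ ()
three-distinct {xs = _ ∷ []} _ (s≤s ())
three-distinct {xs = _ ∷ _ ∷ []} _ (s≤s (s≤s ()))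
three-distinct {xs = a ∷ b ∷ c ∷ _} ((a≢b ∷ a≢c ∷ _) ∷ (b≢c ∷ _) ∷ _) _ =
  a , b , c , (a≢b , a≢c , b≢c) , here refl , there (here refl) , there (there (here refl))

-- König's edge-colouring theorem

data Side : Set where
  left right : Side

opposite : Side → Side
opposite left = right
opposite right = left

opposite-involutive : ∀ s → opposite (opposite s) ≡ s
opposite-involutive left = refl
opposite-involutive right = refl

side-cases : ∀ s s′ → s′ ≡ s ⊎ s′ ≡ opposite s
side-cases left left = inj₁ refl
side-cases left right = inj₂ refl
side-cases right left = inj₂ refl
side-cases right right = inj₁ refl

-- Edge colourings of a bipartite multigraph with edges E and, on each side,
-- vertices V; the edge e joins end left e to end right e.
module EdgeColouring {E V : Set} (_≟E_ : DecidableEquality E) (_≟V_ : DecidableEquality V)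
                     (end : Side → E → V) (k : ℕ) where

  open DecMembership _≟E_ using (_∈?_)

  Colouring : Set
  Colouring = E → Fin k

  Proper : Colouring → List E → Set
  Proper col L = ∀ s {f g} → f ∈ L → g ∈ L → end s f ≡ end s g → col f ≡ col g → f ≡ g

  Misses : Colouring → List E → Side → V → Fin k → Set
  Misses col L s w c = ∀ {g} → g ∈ L → end s g ≡ w → col g ≢ c

  edgesAt : List E → Side → V → List E
  edgesAt L s w = filter (λ g → end s g ≟V w) L

  MaxDegree≤k : List E → Set
  MaxDegree≤k L = ∀ s w → length (edgesAt L s w) ≤ k

  -- α is missing at the left vertex u and β at the right vertex v. Swapping α
  -- and β along the α/β-chain S that starts at v makes α missing at both:
  -- S never reaches u, as it enters left vertices along α-edges.
  module KempeSwap (col : Colouring) (L : List E) (proper : Proper col L)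
                   {α β : Fin k} (α≢β : α ≢ β) {u v : V}
                   (α∉u : Misses col L left u α) (β∉v : Misses col L right v β) where

    Bicoloured : Fin k → Set
    Bicoloured c = c ≡ α ⊎ c ≡ β

    leaving : Side → Fin k
    leaving right = α
    leaving left = β

    Leaves : Side → V → E → Set
    Leaves s w f = end s f ≡ w × col f ≡ leaving s

    leaving-bicoloured : ∀ s → Bicoloured (leaving s)
    leaving-bicoloured right = inj₁ refl
    leaving-bicoloured left = inj₂ refl

    leaving-β⇒left : ∀ s → leaving s ≡ β → s ≡ left
    leaving-β⇒left left _ = refl
    leaving-β⇒left right α≡β = ⊥-elim (α≢β α≡β)

    opposite≡left⇒right : ∀ s → opposite s ≡ left → s ≡ right
    opposite≡left⇒right right _ = refl

    other-colour : ∀ s {c} → Bicoloured c → c ≢ leaving s → c ≡ leaving (opposite s)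
    other-colour right (inj₁ c-α) c≢α = ⊥-elim (c≢α c-α)
    other-colour right (inj₂ c-β) _ = c-β
    other-colour left (inj₁ c-α) _ = c-α
    other-colour left (inj₂ c-β) c≢β = ⊥-elim (c≢β c-β)

    search : ∀ R s w → (∃ λ f → f ∈ R × Leaves s w f) ⊎ (∀ {f} → f ∈ R → ¬ Leaves s w f)
    search R s w with any? (λ f → (end s f ≟V w) ×-dec (col f Fin.≟ leaving s)) R
    ... | yes found = inj₁ (find found)
    ... | no ¬found = inj₂ λ f∈R f-leaves → ¬found (lose f∈R f-leaves)

    chain : ℕ → List E → List E → Side → V → List E
    chain zero H R s w = H
    chain (suc n) H R s w with search R s w
    ... | inj₁ (f , f∈R , _) = chain n (f ∷ H) (R ─ f∈R) (opposite s) (end (opposite s) f)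
    ... | inj₂ _ = H

    ⊆-chain : ∀ n {H R s w} → H ⊆ chain n H R s w
    ⊆-chain zero h = h
    ⊆-chain (suc n) {H} {R} {s} {w} h with search R s w
    ... | inj₁ (f , f∈R , _) = ⊆-chain n (there h)
    ... | inj₂ _ = h

    -- H: the edges visited so far, R: the remaining edges, (s , w): the current vertex.
    record Invariant (H R : List E) (s : Side) (w : V) : Set where
      field
        ⊆H∪R : ∀ {g} → g ∈ L → g ∈ H ⊎ g ∈ R
        R⊆L : R ⊆ L
        H⊆L : H ⊆ L
        bicoloured : ∀ {f} → f ∈ H → Bicoloured (col f)
        β-avoids-u : ∀ {f} → f ∈ H → col f ≡ β → end left f ≢ u
        entered : ∀ {g} → g ∈ L → end s g ≡ w → col g ≡ leaving (opposite s) → g ∈ H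
        left≢u : s ≡ left → w ≢ u
        closed : ∀ s′ {f g} → f ∈ H → g ∈ L → end s′ f ≡ end s′ g →
                 Bicoloured (col g) → col g ≢ col f → g ∈ H ⊎ Leaves s w g

    initial : Invariant [] L right v
    initial = record
      { ⊆H∪R = inj₂ ; R⊆L = λ g∈L → g∈L ; H⊆L = λ () ; bicoloured = λ () ; β-avoids-u = λ ()
      ; entered = λ g∈L g-at-v g-β → ⊥-elim (β∉v g∈L g-at-v g-β) ; left≢u = λ () ; closed = λ _ () }

    module Step {H R s w} (I : Invariant H R s w) {f} (f∈R : f ∈ R) (f-leaves : Leaves s w f) where
      open Invariant I

      f∈L : f ∈ L
      f∈L = R⊆L f∈R

      f-unique : ∀ {g} → g ∈ L → Leaves s w g → g ≡ f
      f-unique g∈L (g-at-w , g-colour) =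
        proper s g∈L f∈L (trans g-at-w (sym (proj₁ f-leaves))) (trans g-colour (sym (proj₂ f-leaves)))

      next-⊆H∪R : ∀ {g} → g ∈ L → g ∈ f ∷ H ⊎ g ∈ (R ─ f∈R)
      next-⊆H∪R g∈L with ⊆H∪R g∈L
      ... | inj₁ g∈H = inj₁ (there g∈H)
      ... | inj₂ g∈R = Sum.map₁ (λ { refl → here refl }) (∈-─⁻ f∈R g∈R)

      next-H⊆L : (f ∷ H) ⊆ L
      next-H⊆L (here refl) = f∈L
      next-H⊆L (there g∈H) = H⊆L g∈H

      next-bicoloured : ∀ {g} → g ∈ f ∷ H → Bicoloured (col g)
      next-bicoloured (here refl) = subst Bicoloured (sym (proj₂ f-leaves)) (leaving-bicoloured s)
      next-bicoloured (there g∈H) = bicoloured g∈H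

      next-β-avoids-u : ∀ {g} → g ∈ f ∷ H → col g ≡ β → end left g ≢ u
      next-β-avoids-u (there g∈H) = β-avoids-u g∈H
      next-β-avoids-u (here refl) f-β f-at-u =
        left≢u s≡left (trans (sym (proj₁ f-leaves)) (subst (λ t → end t f ≡ u) (sym s≡left) f-at-u))
        where s≡left = leaving-β⇒left s (trans (sym (proj₂ f-leaves)) f-β)

      next-entered : ∀ {g} → g ∈ L → end (opposite s) g ≡ end (opposite s) f →
                     col g ≡ leaving (opposite (opposite s)) → g ∈ f ∷ H
      next-entered g∈L g-at-f g-colour =
        here (proper (opposite s) g∈L f∈L g-at-f
          (trans (subst (λ t → _ ≡ leaving t) (opposite-involutive s) g-colour) (sym (proj₂ f-leaves))))

      next-left≢u : opposite s ≡ left → end (opposite s) f ≢ u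
      next-left≢u s̄≡left f-at-u =
        α∉u f∈L (subst (λ t → end t f ≡ u) s̄≡left f-at-u)
          (trans (proj₂ f-leaves) (cong leaving (opposite≡left⇒right s s̄≡left)))

      -- A bicoloured edge at f of the other colour is either the edge by which
      -- the chain entered w, or the next edge of the chain.
      closed-at-f : ∀ s′ {g} → g ∈ L → end s′ f ≡ end s′ g → Bicoloured (col g) → col g ≢ col f →
                    g ∈ f ∷ H ⊎ Leaves (opposite s) (end (opposite s) f) g
      closed-at-f s′ {g} g∈L shared g-bicoloured g≢f =
        Sum.map (λ s′≡s → there (entered g∈L (trans (sym (shared-at s′≡s)) (proj₁ f-leaves)) g-colour))
                (λ s′≡s̄ → sym (shared-at s′≡s̄) , g-colour)
                (side-cases s s′)
        where
        shared-at : ∀ {t} → s′ ≡ t → end t f ≡ end t g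
        shared-at refl = shared
        g-colour : col g ≡ leaving (opposite s)
        g-colour = other-colour s g-bicoloured (λ g-leaving → g≢f (trans g-leaving (sym (proj₂ f-leaves))))

      next-closed : ∀ s′ {f₀ g} → f₀ ∈ f ∷ H → g ∈ L → end s′ f₀ ≡ end s′ g →
                    Bicoloured (col g) → col g ≢ col f₀ →
                    g ∈ f ∷ H ⊎ Leaves (opposite s) (end (opposite s) f) g
      next-closed s′ (here refl) = closed-at-f s′
      next-closed s′ (there f₀∈H) g∈L shared g-bicoloured g≢f₀
        with closed s′ f₀∈H g∈L shared g-bicoloured g≢f₀
      ... | inj₁ g∈H = inj₁ (there g∈H)
      ... | inj₂ g-leaves = inj₁ (here (f-unique g∈L g-leaves))

      invariant : Invariant (f ∷ H) (R ─ f∈R) (opposite s) (end (opposite s) f)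
      invariant = record
        { ⊆H∪R = next-⊆H∪R ; R⊆L = R⊆L ∘ ─-⊆ f∈R ; H⊆L = next-H⊆L ; bicoloured = next-bicoloured
        ; β-avoids-u = next-β-avoids-u ; entered = next-entered ; left≢u = next-left≢u
        ; closed = next-closed }

    record Closed (S : List E) : Set where
      field
        S⊆L : S ⊆ L
        bicoloured : ∀ {f} → f ∈ S → Bicoloured (col f)
        β-avoids-u : ∀ {f} → f ∈ S → col f ≡ β → end left f ≢ u
        closed : ∀ s′ {f g} → f ∈ S → g ∈ L → end s′ f ≡ end s′ g →
                 Bicoloured (col g) → col g ≢ col f → g ∈ S

    module _ {H R s w} (I : Invariant H R s w) (stuck : ∀ {g} → g ∈ R → ¬ Leaves s w g) where
      open Invariant I

      stuck-leaves : ∀ {g} → g ∈ L → Leaves s w g → g ∈ H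
      stuck-leaves g∈L g-leaves with ⊆H∪R g∈L
      ... | inj₁ g∈H = g∈H
      ... | inj₂ g∈R = ⊥-elim (stuck g∈R g-leaves)

      stuck-closed : Closed H
      stuck-closed = record
        { S⊆L = H⊆L ; bicoloured = bicoloured ; β-avoids-u = β-avoids-u
        ; closed = λ s′ f∈H g∈L shared g-bicoloured g≢f →
            Sum.[ (λ g∈H → g∈H) , stuck-leaves g∈L ] (closed s′ f∈H g∈L shared g-bicoloured g≢f) }

    chain-closed : ∀ n {H R s w} → length R ≤ n → Invariant H R s w → Closed (chain n H R s w)
    chain-closed zero {R = []} _ I = stuck-closed I λ ()
    chain-closed (suc n) {H} {R} {s} {w} |R|≤1+n I with search R s w
    ... | inj₁ (f , f∈R , f-leaves) =
      chain-closed n (ℕ.≤-pred (subst (_≤ suc n) (length-─ f∈R) |R|≤1+n)) (Step.invariant I f∈R f-leaves)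
    ... | inj₂ stuck = stuck-closed I stuck

    chain-leaves : ∀ n {H R s w} → length R ≤ n → Invariant H R s w →
                   ∀ {g} → g ∈ L → Leaves s w g → g ∈ chain n H R s w
    chain-leaves zero {R = []} _ I = stuck-leaves I λ ()
    chain-leaves (suc n) {H} {R} {s} {w} _ I g∈L g-leaves with search R s w
    ... | inj₁ (f , f∈R , f-leaves) = ⊆-chain n (here (Step.f-unique I f∈R f-leaves g∈L g-leaves))
    ... | inj₂ stuck = stuck-leaves I stuck g∈L g-leaves

    S : List E
    S = chain (length L) [] L right v

    S-closed : Closed S
    S-closed = chain-closed (length L) ≤-refl initial
    open Closed S-closed

    α-at-v∈S : ∀ {g} → g ∈ L → end right g ≡ v → col g ≡ α → g ∈ S
    α-at-v∈S g∈L g-at-v g-α = chain-leaves (length L) ≤-refl initial g∈L (g-at-v , g-α)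

    swap : Permutation k k
    swap = transpose α β

    swap-α : swap ⟨$⟩ʳ α ≡ β
    swap-α rewrite dec-true (α Fin.≟ α) refl = refl

    swap-β : swap ⟨$⟩ʳ β ≡ α
    swap-β rewrite dec-false (β Fin.≟ α) (α≢β ∘ sym) | dec-true (β Fin.≟ β) refl = refl

    swap-bicoloured : ∀ {c} → Bicoloured c → Bicoloured (swap ⟨$⟩ʳ c) × swap ⟨$⟩ʳ c ≢ c
    swap-bicoloured (inj₁ refl) = inj₂ swap-α , α≢β ∘ sym ∘ trans (sym swap-α)
    swap-bicoloured (inj₂ refl) = inj₁ swap-β , α≢β ∘ trans (sym swap-β)

    swap-injective : ∀ {c d} → swap ⟨$⟩ʳ c ≡ swap ⟨$⟩ʳ d → c ≡ d
    swap-injective {c} {d} eq = trans (sym (inverseˡ swap)) (trans (cong (swap ⟨$⟩ˡ_) eq) (inverseˡ swap))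

    recolour : Colouring
    recolour g = if does (g ∈? S) then swap ⟨$⟩ʳ col g else col g

    recolour-∈ : ∀ {g} → g ∈ S → recolour g ≡ swap ⟨$⟩ʳ col g
    recolour-∈ {g} g∈S rewrite dec-true (g ∈? S) g∈S = refl

    recolour-∉ : ∀ {g} → g ∉ S → recolour g ≡ col g
    recolour-∉ {g} g∉S rewrite dec-false (g ∈? S) g∉S = refl

    -- An edge outside S meeting an edge of S cannot take the swapped colour of
    -- that edge, as S is closed under bicoloured neighbours of the other colour.
    swapped≢outside : ∀ s′ {f g} → f ∈ S → g ∉ S → g ∈ L → end s′ f ≡ end s′ g →
                      swap ⟨$⟩ʳ col f ≢ col g
    swapped≢outside s′ f∈S g∉S g∈L shared swapped≡g =
      g∉S (closed s′ f∈S g∈L shared (subst Bicoloured swapped≡g swapped-bicoloured)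
                 (λ g≡f → swapped≢f (trans swapped≡g g≡f)))
      where
      swapped-bicoloured = proj₁ (swap-bicoloured (bicoloured f∈S))
      swapped≢f = proj₂ (swap-bicoloured (bicoloured f∈S))

    recolour-proper : Proper recolour L
    recolour-proper s {f} {g} f∈L g∈L shared same = by-membership (f ∈? S) (g ∈? S)
      where
      by-membership : Dec (f ∈ S) → Dec (g ∈ S) → f ≡ g
      by-membership (yes f∈S) (yes g∈S) = proper s f∈L g∈L shared
        (swap-injective (trans (sym (recolour-∈ f∈S)) (trans same (recolour-∈ g∈S))))
      by-membership (yes f∈S) (no g∉S) = ⊥-elim (swapped≢outside s f∈S g∉S g∈L shared
        (trans (sym (recolour-∈ f∈S)) (trans same (recolour-∉ g∉S))))
      by-membership (no f∉S) (yes g∈S) = ⊥-elim (swapped≢outside s g∈S f∉S f∈L (sym shared)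
        (trans (sym (recolour-∈ g∈S)) (trans (sym same) (recolour-∉ f∉S))))
      by-membership (no f∉S) (no g∉S) = proper s f∈L g∈L shared
        (trans (sym (recolour-∉ f∉S)) (trans same (recolour-∉ g∉S)))

    recolour-swapped-α : ∀ {g} → g ∈ S → recolour g ≡ α → col g ≡ β
    recolour-swapped-α {g} g∈S g-α with bicoloured g∈S
    ... | inj₁ was-α =
      ⊥-elim (proj₂ (swap-bicoloured (inj₁ was-α)) (trans (sym (recolour-∈ g∈S)) (trans g-α (sym was-α))))
    ... | inj₂ was-β = was-β

    recolour-misses-α-at-u : Misses recolour L left u α
    recolour-misses-α-at-u {g} g∈L g-at-u g-α = by-membership (g ∈? S)
      where
      by-membership : Dec (g ∈ S) → ⊥
      by-membership (yes g∈S) = β-avoids-u g∈S (recolour-swapped-α g∈S g-α) g-at-u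
      by-membership (no g∉S) = α∉u g∈L g-at-u (trans (sym (recolour-∉ g∉S)) g-α)

    recolour-misses-α-at-v : Misses recolour L right v α
    recolour-misses-α-at-v {g} g∈L g-at-v g-α = by-membership (g ∈? S)
      where
      by-membership : Dec (g ∈ S) → ⊥
      by-membership (yes g∈S) = β∉v g∈L g-at-v (recolour-swapped-α g∈S g-α)
      by-membership (no g∉S) = g∉S (α-at-v∈S g∈L g-at-v (trans (sym (recolour-∉ g∉S)) g-α))

  assign : Colouring → E → Fin k → Colouring
  assign col e c g = if does (g ≟E e) then c else col g

  assign-≡ : ∀ col e c → assign col e c e ≡ c
  assign-≡ col e c rewrite dec-true (e ≟E e) refl = refl

  assign-≢ : ∀ col e c {g} → g ≢ e → assign col e c g ≡ col g
  assign-≢ col e c {g} g≢e rewrite dec-false (g ≟E e) g≢e = refl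

  assign-proper : ∀ {col L e c} → e ∉ L → Proper col L → (∀ s → Misses col L s (end s e) c) →
                  Proper (assign col e c) (e ∷ L)
  assign-proper {col} {L} {e} {c} e∉L proper c-missing = proper′
    where
    assign-L : ∀ {g} → g ∈ L → assign col e c g ≡ col g
    assign-L g∈L = assign-≢ col e c λ { refl → e∉L g∈L }
    proper′ : Proper (assign col e c) (e ∷ L)
    proper′ s (here refl) (here refl) _ _ = refl
    proper′ s (here refl) (there g∈L) shared same =
      ⊥-elim (c-missing s g∈L (sym shared) (trans (sym (assign-L g∈L)) (trans (sym same) (assign-≡ col e c))))
    proper′ s (there f∈L) (here refl) shared same =
      ⊥-elim (c-missing s f∈L shared (trans (sym (assign-L f∈L)) (trans same (assign-≡ col e c))))
    proper′ s (there f∈L) (there g∈L) shared same =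
      proper s f∈L g∈L shared (trans (sym (assign-L f∈L)) (trans same (assign-L g∈L)))

  missing-colour : ∀ col L s w → length (edgesAt L s w) < k → ∃ (Misses col L s w)
  missing-colour col L s w deg<k
    with c , c∉ ← length<⇒∃∉ (map col (edgesAt L s w)) (subst (_< k) (sym (length-map col (edgesAt L s w))) deg<k)
    = c , λ g∈L g-at-w g-c →
        c∉ (subst (_∈ _) g-c (∈-map⁺ col (∈-filter⁺ (λ g → end s g ≟V w) g∈L g-at-w)))

  common-missing-colour : ∀ {col L} → Proper col L → ∀ {u v} →
                          length (edgesAt L left u) < k → length (edgesAt L right v) < k →
                          ∃ λ col′ → Proper col′ L ×
                            ∃ λ c → Misses col′ L left u c × Misses col′ L right v c
  common-missing-colour {col} {L} proper {u} {v} deg-u<k deg-v<k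
    with missing-colour col L left u deg-u<k | missing-colour col L right v deg-v<k
  ... | α , α∉u | β , β∉v with α Fin.≟ β
  ...   | yes refl = col , proper , α , α∉u , β∉v
  ...   | no α≢β = recolour , recolour-proper , α , recolour-misses-α-at-u , recolour-misses-α-at-v
    where open KempeSwap col L proper α≢β α∉u β∉v

  MaxDegree≤k-tail : ∀ {e L} → MaxDegree≤k (e ∷ L) → MaxDegree≤k L
  MaxDegree≤k-tail {e} {L} deg s w = ≤-trans (length-filter-∷ _ e L) (deg s w)

  MaxDegree≤k-head : ∀ {e L} → MaxDegree≤k (e ∷ L) → ∀ s → length (edgesAt L s (end s e)) < k
  MaxDegree≤k-head {e} {L} deg s =
    subst (_≤ k) (cong length (filter-accept (λ g → end s g ≟V end s e) refl)) (deg s (end s e))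

  maxDegree⇒proper : 0 < k → ∀ L → Unique L → MaxDegree≤k L → ∃ λ col → Proper col L
  maxDegree⇒proper 0<k [] _ _ = (λ _ → Fin.fromℕ< 0<k) , λ _ ()
  maxDegree⇒proper 0<k (e ∷ L) eL-unique@(_ ∷ L-unique) deg
    with col , proper ← maxDegree⇒proper 0<k L L-unique (MaxDegree≤k-tail deg)
    with col′ , proper′ , c , c∉left , c∉right ←
           common-missing-colour proper (MaxDegree≤k-head deg left) (MaxDegree≤k-head deg right)
    = assign col′ e c ,
      assign-proper (Unique[x∷xs]⇒x∉xs eL-unique) proper′ λ { left → c∉left ; right → c∉right }

-- Blocks of a sorted list

SortedBy : ∀ {A : Set} → (A → ℚ) → List A → Set
SortedBy key = AllPairs (λ x y → key x ℚ.≤ key y)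

module Blocks {A : Set} (_≟_ : DecidableEquality A) (k′ : ℕ) where
  open DecMembership _≟_ using (_∈?_)

  k : ℕ
  k = suc k′

  block : ℕ → List A → List A
  block b xs = take k (drop (b * k) xs)

  block-suc : ∀ b xs → block (suc b) xs ≡ block b (drop k xs)
  block-suc b xs = cong (take k) (sym (drop-drop k (b * k) xs))

  block-⊆ : ∀ b xs → block b xs ⊆ xs
  block-⊆ b xs = drop-⊆ (b * k) xs ∘ take-⊆ k (drop (b * k) xs)

  length-block : ∀ b xs → length (block b xs) ≤ k
  length-block b xs = subst (_≤ k) (sym (length-take k (drop (b * k) xs))) (ℕ.m⊓n≤m k _)

  length-drop-k : ∀ n (xs : List A) → length xs ≤ suc n → length (drop k xs) ≤ n
  length-drop-k n xs |xs|≤1+n = begin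
    length (drop k xs) ≡⟨ length-drop k xs ⟩
    length xs ∸ k      ≤⟨ ℕ.∸-monoˡ-≤ k |xs|≤1+n ⟩
    n ∸ k′             ≤⟨ ℕ.m∸n≤m n k′ ⟩
    n                  ∎
    where open ≤-Reasoning

  -- The fuel n ≥ length xs bounds the number of blocks to inspect.
  blockIndexWithin : ℕ → List A → A → ℕ
  blockIndexWithin zero xs x = 0
  blockIndexWithin (suc n) xs x with x ∈? take k xs
  ... | yes _ = 0
  ... | no _ = suc (blockIndexWithin n (drop k xs) x)

  blockIndex : List A → A → ℕ
  blockIndex xs = blockIndexWithin (length xs) xs

  ∈-block-blockIndexWithin : ∀ n xs {x} → length xs ≤ n → x ∈ xs → x ∈ block (blockIndexWithin n xs x) xs
  ∈-block-blockIndexWithin zero [] _ ()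
  ∈-block-blockIndexWithin (suc n) xs {x} |xs|≤1+n x∈xs with x ∈? take k xs
  ... | yes x∈take = x∈take
  ... | no x∉take = subst (x ∈_) (sym (block-suc (blockIndexWithin n (drop k xs) x) xs))
    (∈-block-blockIndexWithin n (drop k xs) (length-drop-k n xs |xs|≤1+n) x∈drop)
    where
    x∈drop : x ∈ drop k xs
    x∈drop with ∈-++⁻ (take k xs) (subst (x ∈_) (sym (take++drop≡id k xs)) x∈xs)
    ... | inj₁ x∈take = ⊥-elim (x∉take x∈take)
    ... | inj₂ x∈drop = x∈drop

  blockIndexWithin-block : ∀ n {xs x} b → length xs ≤ n → Unique xs → x ∈ block b xs →
                           blockIndexWithin n xs x ≡ b
  blockIndexWithin-block zero {[]} zero _ _ ()
  blockIndexWithin-block zero {[]} (suc b) _ _ ()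
  blockIndexWithin-block (suc n) {xs} {x} b |xs|≤1+n xs-unique x∈block with x ∈? take k xs | b
  ... | yes _ | zero = refl
  ... | yes x∈take | suc b′ = ⊥-elim (take-drop-disjoint k xs-unique x∈take
    (block-⊆ b′ (drop k xs) (subst (x ∈_) (block-suc b′ xs) x∈block)))
  ... | no x∉take | zero = ⊥-elim (x∉take x∈block)
  ... | no _ | suc b′ = cong suc (blockIndexWithin-block n b′ (length-drop-k n xs |xs|≤1+n)
                                    (Unique.drop⁺ k xs-unique) (subst (x ∈_) (block-suc b′ xs) x∈block))

  ∈-block-blockIndex : ∀ {xs x} → x ∈ xs → x ∈ block (blockIndex xs x) xs
  ∈-block-blockIndex {xs} = ∈-block-blockIndexWithin (length xs) xs ≤-refl

  blockIndex-block : ∀ {xs x} b → Unique xs → x ∈ block b xs → blockIndex xs x ≡ b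
  blockIndex-block b = blockIndexWithin-block _ b ≤-refl

  module Window (key : A → ℚ) (lo hi : ℚ) where

    Inside : A → Set
    Inside x = lo ℚ.< key x × key x ℚ.< hi

    inside? : Decidable Inside
    inside? x = (lo ℚ.<? key x) ×-dec (key x ℚ.<? hi)

    count : List A → ℕ
    count xs = length (filter inside? xs)

    FullInside : List A → Set
    FullInside ys = length ys ≡ k × All Inside ys

    count-++ : ∀ xs ys → count (xs ++ ys) ≡ count xs + count ys
    count-++ xs ys = trans (cong length (filter-++ inside? xs ys)) (length-++ (filter inside? xs))

    count-take-drop : ∀ m xs → count xs ≡ count (take m xs) + count (drop m xs)
    count-take-drop m xs = trans (cong count (sym (take++drop≡id m xs))) (count-++ (take m xs) (drop m xs))

    count≤length : ∀ xs → count xs ≤ length xs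
    count≤length = length-filter inside?

    0<count⇒∃ : ∀ xs → 0 < count xs → ∃ λ x → x ∈ xs × Inside x
    0<count⇒∃ xs 0<count with any? inside? xs
    ... | yes some-inside = find some-inside
    ... | no none-inside = ⊥-elim (ℕ.<-irrefl (sym count≡0) 0<count)
      where count≡0 = cong length (filter-none inside? (¬Any⇒All¬ xs none-inside))

    take-full : ∀ xs → k ≤ count xs → length (take k xs) ≡ k
    take-full xs k≤count = trans (length-take k xs) (ℕ.m≤n⇒m⊓n≡m (≤-trans k≤count (count≤length xs)))

    count-beyond : ∀ {x xs} → SortedBy key (x ∷ xs) → hi ℚ.≤ key x → count (x ∷ xs) ≡ 0
    count-beyond {x} (x≤xs ∷ _) hi≤x =
      cong length (filter-none inside? (outside x ℚ.≤-refl ∷ All.map (outside _) x≤xs))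
      where
      outside : ∀ y → key x ℚ.≤ key y → ¬ Inside y
      outside y x≤y (_ , y<hi) = ℚ.<-irrefl refl (ℚ.<-≤-trans y<hi (ℚ.≤-trans hi≤x x≤y))

    -- Everything from an element beyond hi on lies outside the window.
    count<-beyond : ∀ n {xs x} → SortedBy key xs → x ∈ take n xs → hi ℚ.≤ key x → count xs < n
    count<-beyond (suc n) {y ∷ xs} sorted (here refl) hi≤x =
      subst (_< suc n) (sym (count-beyond sorted hi≤x)) (s≤s z≤n)
    count<-beyond (suc n) {y ∷ xs} (_ ∷ sorted) (there x∈take) hi≤x = begin-strict
      count (y ∷ xs)        ≡⟨ count-++ [ y ] xs ⟩
      count [ y ] + count xs ≤⟨ ℕ.+-monoˡ-≤ (count xs) (count≤length [ y ]) ⟩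
      suc (count xs)        <⟨ s≤s (count<-beyond n sorted x∈take hi≤x) ⟩
      suc n                 ∎
      where open ≤-Reasoning

    count-not-all : ∀ ys → ¬ All Inside ys → length ys ≤ k → count ys ≤ k′
    count-not-all ys ¬all-inside |ys|≤k =
      ℕ.≤-pred (≤-trans (filter-notAll inside? ys (¬All⇒Any¬ inside? ys ¬all-inside)) |ys|≤k)

    second-block-inside : ∀ {xs c} → SortedBy key xs → c ∈ take k xs → Inside c → k ≤ count (drop k xs) →
                          FullInside (block 1 xs)
    second-block-inside {xs} {c} sorted c∈first (lo<c , _) k≤count-rest
      with all? inside? (take k (drop k xs))
    ... | yes all-inside = subst FullInside (sym (block-suc 0 xs)) (take-full (drop k xs) k≤count-rest , all-inside)
    ... | no ¬all-inside with find (¬All⇒Any¬ inside? _ ¬all-inside)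
    ...   | d , d∈second , d-outside =
      ⊥-elim (ℕ.<⇒≱ (count<-beyond k (AllPairs.drop⁺ k sorted) d∈second hi≤d) k≤count-rest)
      where
      c≤d = AllPairs-take-drop k sorted c∈first (take-⊆ k (drop k xs) d∈second)
      hi≤d = ℚ.≮⇒≥ (λ d<hi → d-outside (ℚ.<-≤-trans lo<c c≤d , d<hi))

    -- a: points of the window in a first block that is not inside it, b: in the rest.
    split-count : ∀ {a b} → k + k′ ≤ a + b → a ≤ k′ → ¬ (k + k′ ≤ b) → 0 < a × k ≤ b
    split-count {zero} many _ few = ⊥-elim (few many)
    split-count {suc a} {b} many a≤k′ _ = s≤s z≤n , ℕ.+-cancelʳ-≤ k′ k b (begin
      k + k′      ≤⟨ many ⟩
      suc a + b   ≤⟨ ℕ.+-monoˡ-≤ b a≤k′ ⟩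
      k′ + b      ≡⟨ ℕ.+-comm k′ b ⟩
      b + k′      ∎)
      where open ≤-Reasoning

    full-inside-block : ∀ n xs → length xs ≤ n → SortedBy key xs → k + k′ ≤ count xs →
                        ∃ λ b → FullInside (block b xs)
    full-inside-block zero [] _ _ ()
    full-inside-block (suc n) xs |xs|≤1+n sorted many with all? inside? (take k xs)
    ... | yes all-inside = 0 , take-full xs (≤-trans (ℕ.m≤m+n k k′) many) , all-inside
    ... | no ¬all-inside with (k + k′) ℕ.≤? count (drop k xs)
    ...   | yes many-rest =
      let b , full = full-inside-block n (drop k xs) (length-drop-k n xs |xs|≤1+n) (AllPairs.drop⁺ k sorted) many-rest
      in suc b , subst FullInside (sym (block-suc b xs)) full
    ...   | no few-rest =
      let 0<count-first , k≤count-rest = split-count (subst (k + k′ ≤_) (count-take-drop k xs) many)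
                                           (count-not-all (take k xs) ¬all-inside (length-block 0 xs)) few-rest
          c , c∈first , c-inside = 0<count⇒∃ (take k xs) 0<count-first
      in 1 , second-block-inside sorted c∈first c-inside k≤count-rest

-- The upper bound

_≟P_ : DecidableEquality Point
_≟P_ = ≡-dec ℚ._≟_ ℚ._≟_

coordinate : Side → Point → ℚ
coordinate left = proj₁
coordinate right = proj₂

byCoordinate : Side → DecTotalOrder _ _ _
byCoordinate s = On.decTotalOrder ℚ.≤-decTotalOrder (coordinate s)

module BlockColouring (k′ : ℕ) (V : List Point) (V-unique : Unique V) where
  open Blocks _≟P_ k′

  sortedBy : Side → List Point
  sortedBy s = Sort.sort (byCoordinate s) V

  sortedBy-↭ : ∀ s → sortedBy s ↭ V
  sortedBy-↭ s = Sort.sort-↭ (byCoordinate s) V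

  sortedBy-sorted : ∀ s → SortedBy (coordinate s) (sortedBy s)
  sortedBy-sorted s = Sorted⇒AllPairs (DecTotalOrder.totalOrder (byCoordinate s)) (Sort.sort-↗ (byCoordinate s) V)

  sortedBy-unique : ∀ s → Unique (sortedBy s)
  sortedBy-unique s = PermutationSetoid.Unique-resp-↭ (setoid Point) (↭⇒↭ₛ (↭-sym (sortedBy-↭ s))) V-unique

  end : Side → Point → ℕ
  end s = blockIndex (sortedBy s)

  open EdgeColouring _≟P_ ℕ._≟_ end k

  maxDegree≤k : MaxDegree≤k V
  maxDegree≤k s b = ≤-trans (Unique⇒length≤ (Unique.filter⁺ _ V-unique) edgesAt⊆block) (length-block b (sortedBy s))
    where
    edgesAt⊆block : edgesAt V s b ⊆ block b (sortedBy s)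
    edgesAt⊆block p∈edges with ∈-filter⁻ (λ q → end s q ℕ.≟ b) p∈edges
    ... | p∈V , refl = ∈-block-blockIndex (∈-resp-↭ (↭-sym (sortedBy-↭ s)) p∈V)

  colouring : Point → Fin k
  colouring = proj₁ (maxDegree⇒proper (s≤s z≤n) V V-unique maxDegree≤k)

  colouring-proper : Proper colouring V
  colouring-proper = proj₂ (maxDegree⇒proper (s≤s z≤n) V V-unique maxDegree≤k)

  block-rainbow : ∀ s b → length (block b (sortedBy s)) ≡ k →
                  ∀ j → ∃ λ p → p ∈ block b (sortedBy s) × colouring p ≡ j
  block-rainbow s b full j =
    let p , p∈block , j≡p = ∈-map⁻ colouring (Unique∧length≡⇒∈ (map colouring C) colours-unique
                                                  (trans (length-map colouring C) full) j)
    in p , p∈block , sym j≡p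
    where
    C = block b (sortedBy s)
    C⊆V : C ⊆ V
    C⊆V = ∈-resp-↭ (sortedBy-↭ s) ∘ block-⊆ b (sortedBy s)
    same-end : ∀ {p} → p ∈ C → end s p ≡ b
    same-end = blockIndex-block b (sortedBy-unique s)
    colours-unique : Unique (map colouring C)
    colours-unique = Unique-map⁺
      (λ p∈C q∈C → colouring-proper s (C⊆V p∈C) (C⊆V q∈C) (trans (same-end p∈C) (sym (same-end q∈C))))
      (Unique.take⁺ k (Unique.drop⁺ (b * k) (sortedBy-unique s)))

  strip-rainbow : ∀ s lo hi → let open Window (coordinate s) lo hi in
                  k + k′ ≤ count V → ∀ j → ∃ λ p → p ∈ V × Inside p × colouring p ≡ j
  strip-rainbow s lo hi many j =
    let b , full , all-inside = full-inside-block _ (sortedBy s) ≤-refl (sortedBy-sorted s)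
                                  (subst (k + k′ ≤_) (sym (↭-length (filter-↭ inside? (sortedBy-↭ s)))) many)
        p , p∈block , p-j = block-rainbow s b full j
    in p , ∈-resp-↭ (sortedBy-↭ s) (block-⊆ b (sortedBy s) p∈block) , All.lookup all-inside p∈block , p-j
    where open Window (coordinate s) lo hi

4k∸3≡ : ∀ k′ → 4 * suc k′ ∸ 3 ≡ suc ((k′ + k′) + (k′ + k′))
4k∸3≡ k′ = trans (cong (_∸ 3) (4k≡ k′)) (ℕ.m+n∸m≡n 3 _)
  where
  open +-*-Solver
  4k≡ : ∀ k′ → 4 * suc k′ ≡ 3 + suc ((k′ + k′) + (k′ + k′))
  4k≡ = solve 1 (λ k′ → con 4 :* (con 1 :+ k′) := con 3 :+ (con 1 :+ ((k′ :+ k′) :+ (k′ :+ k′)))) refl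

≥4k∸3⇒≥2k∸1 : ∀ k′ {a b} → 4 * suc k′ ∸ 3 ≤ a + b → suc k′ + k′ ≤ a ⊎ suc k′ + k′ ≤ b
≥4k∸3⇒≥2k∸1 k′ {a} {b} big with suc k′ + k′ ℕ.≤? a | suc k′ + k′ ℕ.≤? b
... | yes many-a | _ = inj₁ many-a
... | no _ | yes many-b = inj₂ many-b
... | no few-a | no few-b = ⊥-elim (ℕ.<-irrefl refl (begin-strict
  a + b                           ≤⟨ ℕ.+-mono-≤ (ℕ.≤-pred (ℕ.≰⇒> few-a)) (ℕ.≤-pred (ℕ.≰⇒> few-b)) ⟩
  (k′ + k′) + (k′ + k′)           <⟨ ℕ.n<1+n _ ⟩
  suc ((k′ + k′) + (k′ + k′))     ≡⟨ sym (4k∸3≡ k′) ⟩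
  4 * suc k′ ∸ 3                  ≤⟨ big ⟩
  a + b                           ∎))
  where open ≤-Reasoning

upper-bound : ∀ k′ → Good (suc k′) (4 * suc k′ ∸ 3)
upper-bound k′ H = colouring , polychromatic
  where
  open HypA⁺ H
  open BlockColouring k′ V distinct
  polychromatic : ∀ s → E s → 4 * suc k′ ∸ 3 ≤ edgeSize V s →
                  ∀ j → ∃ λ p → p ∈ V × InCross s p × colouring p ≡ j
  polychromatic (cross x₀ x₁ y₀ y₁) _ big j
    with ≥4k∸3⇒≥2k∸1 k′ (≤-trans big (length-filter-⊎ _ _ V))
  ... | inj₁ many-in-horizontal =
    let p , p∈V , p-inside , p-j = strip-rainbow right y₀ y₁ many-in-horizontal j in p , p∈V , inj₁ p-inside , p-j
  ... | inj₂ many-in-vertical =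
    let p , p∈V , p-inside , p-j = strip-rainbow left x₀ x₁ many-in-vertical j in p , p∈V , inj₂ p-inside , p-j

-- The lower bound

-- Eight clusters, with x-ranks 0, …, 7 and y-ranks yRank. Any three of them
-- contain two that are adjacent in the x- or the y-order; a band of width 2
-- over those two and a band of width 1 over the third cut out exactly the three
-- (checked by evaluation in crossFor-exact).
xRank : Fin 8 → ℕ
xRank = toℕ

yRank : Fin 8 → ℕ
yRank = Vec.lookup (2 ∷ 0 ∷ 3 ∷ 1 ∷ 6 ∷ 4 ∷ 7 ∷ 5 ∷ [])

record Bands : Set where
  constructor bands
  field
    x-from x-width y-from y-width : ℕ

Selects : Bands → Fin 8 → Set
Selects (bands px wx py wy) a = (px ≤ xRank a × xRank a < px + wx) ⊎ (py ≤ yRank a × yRank a < py + wy)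

selects? : ∀ B a → Dec (Selects B a)
selects? (bands px wx py wy) a =
  ((px ℕ.≤? xRank a) ×-dec (xRank a ℕ.<? px + wx)) ⊎-dec ((py ℕ.≤? yRank a) ×-dec (yRank a ℕ.<? py + wy))

pairCross : Fin 8 → Fin 8 → Fin 8 → Maybe Bands
pairCross a b c =
  if suc (xRank a) ≡ᵇ xRank b then just (bands (xRank a) 2 (yRank c) 1)
  else if suc (yRank a) ≡ᵇ yRank b then just (bands (xRank c) 1 (yRank a) 2)
  else nothing

crossFor : Fin 8 → Fin 8 → Fin 8 → Bands
crossFor a b c = fromMaybe (bands 0 0 0 0)
  (pairCross a b c <∣> pairCross b a c <∣> pairCross a c b <∣>
   pairCross c a b <∣> pairCross b c a <∣> pairCross c b a)

OneOf : Fin 8 → Fin 8 → Fin 8 → Fin 8 → Set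
OneOf a b c d = d ≡ a ⊎ d ≡ b ⊎ d ≡ c

SelectsExactly : Bands → Fin 8 → Fin 8 → Fin 8 → Set
SelectsExactly B a b c = ∀ d → (Selects B d → OneOf a b c d) × (OneOf a b c d → Selects B d)

crossFor-exact : ∀ a b c → Distinct a b c → SelectsExactly (crossFor a b c) a b c
crossFor-exact = toWitness {a? = Fin.all? λ a → Fin.all? λ b → Fin.all? λ c → distinct? a b c →-dec exact? a b c} _
  where
  distinct? : ∀ a b c → Dec (Distinct a b c)
  distinct? a b c = ¬? (a Fin.≟ b) ×-dec ¬? (a Fin.≟ c) ×-dec ¬? (b Fin.≟ c)
  oneOf? : ∀ a b c d → Dec (OneOf a b c d)
  oneOf? a b c d = (d Fin.≟ a) ⊎-dec (d Fin.≟ b) ⊎-dec (d Fin.≟ c)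
  exact? : ∀ a b c → Dec (SelectsExactly (crossFor a b c) a b c)
  exact? a b c = Fin.all? λ d →
    (selects? (crossFor a b c) d →-dec oneOf? a b c d) ×-dec (oneOf? a b c d →-dec selects? (crossFor a b c) d)

toℚ : ℕ → ℚ
toℚ n = mkℚ (ℤ.+ n) 0 (Coprime.sym (Coprime.1-coprimeTo n))

toℚ-mono-< : ∀ {m n} → m < n → toℚ m ℚ.< toℚ n
toℚ-mono-< {m} {n} m<n =
  *<* (subst₂ ℤ._<_ (sym (ℤ.*-identityʳ (ℤ.+ m))) (sym (ℤ.*-identityʳ (ℤ.+ n))) (ℤ.+<+ m<n))

toℚ-cancel-< : ∀ {m n} → toℚ m ℚ.< toℚ n → m < n
toℚ-cancel-< {m} {n} (*<* m<n) =
  ℤ.drop‿+<+ (subst₂ ℤ._<_ (ℤ.*-identityʳ (ℤ.+ m)) (ℤ.*-identityʳ (ℤ.+ n)) m<n)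

toℚ-injective : ∀ {m n} → toℚ m ≡ toℚ n → m ≡ n
toℚ-injective eq = ℤ.+-injective (cong ℚ.numerator eq)

module _ {g i : ℕ} (i<g : i < g) where

  *≤*+⇒≤ : ∀ {p c} → p * g ≤ c * g + i → p ≤ c
  *≤*+⇒≤ {p} {c} le = ℕ.≤-pred (ℕ.*-cancelʳ-< g p (suc c) (ℕ.≤-<-trans le (begin-strict
    c * g + i <⟨ ℕ.+-monoʳ-< (c * g) i<g ⟩
    c * g + g ≡⟨ ℕ.+-comm (c * g) g ⟩
    suc c * g ∎)))
    where open ℕ.≤-Reasoning

  <⇒*+<* : ∀ {c q} → c < q → c * g + i < q * g
  <⇒*+<* {c} {q} c<q = begin-strict
    c * g + i <⟨ ℕ.+-monoʳ-< (c * g) i<g ⟩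
    c * g + g ≡⟨ ℕ.+-comm (c * g) g ⟩
    suc c * g ≤⟨ ℕ.*-monoˡ-≤ g c<q ⟩
    q * g     ∎
    where open ℕ.≤-Reasoning

≤⇒*≤*+ : ∀ {g i p c} → p ≤ c → p * g ≤ c * g + i
≤⇒*≤*+ {g} {i} p≤c = ℕ.≤-trans (ℕ.*-monoˡ-≤ g p≤c) (ℕ.m≤m+n _ i)

*+<*⇒< : ∀ {g i c q} → c * g + i < q * g → c < q
*+<*⇒< {g} {i} {c} {q} lt = ℕ.*-cancelʳ-< g c q (ℕ.≤-<-trans (ℕ.m≤m+n (c * g) i) lt)

-- Cluster a is the diagonal run of g points (1 + xRank a · g + i , 1 + yRank a · g + i),
-- i < g; the shift by 1 lets a cross bounded by multiples of g use strict inequalities.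
module Clusters (g : ℕ) where

  point : Fin 8 → ℕ → Point
  point a i = toℚ (suc (xRank a * g + i)) , toℚ (suc (yRank a * g + i))

  crossOf : Bands → Cross
  crossOf (bands px wx py wy) =
    cross (toℚ (px * g)) (toℚ (suc ((px + wx) * g))) (toℚ (py * g)) (toℚ (suc ((py + wy) * g)))

  InBand : ℕ → ℕ → ℕ → ℕ → Set
  InBand p w c i = toℚ (p * g) ℚ.< toℚ (suc (c * g + i)) × toℚ (suc (c * g + i)) ℚ.< toℚ (suc ((p + w) * g))

  inBand⁻ : ∀ {p w c i} → i < g → InBand p w c i → p ≤ c × c < p + w
  inBand⁻ i<g (lower , upper) =
    *≤*+⇒≤ i<g (ℕ.≤-pred (toℚ-cancel-< lower)) , *+<*⇒< (ℕ.≤-pred (toℚ-cancel-< upper))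

  inBand⁺ : ∀ {p w c i} → i < g → p ≤ c × c < p + w → InBand p w c i
  inBand⁺ i<g (p≤c , c<p+w) = toℚ-mono-< (s≤s (≤⇒*≤*+ p≤c)) , toℚ-mono-< (s≤s (<⇒*+<* i<g c<p+w))

  InCross-point⁻ : ∀ B a {i} → i < g → InCross (crossOf B) (point a i) → Selects B a
  InCross-point⁻ (bands _ _ _ _) a i<g (inj₁ in-y) = inj₂ (inBand⁻ i<g in-y)
  InCross-point⁻ (bands _ _ _ _) a i<g (inj₂ in-x) = inj₁ (inBand⁻ i<g in-x)

  InCross-point⁺ : ∀ B a {i} → i < g → Selects B a → InCross (crossOf B) (point a i)
  InCross-point⁺ (bands _ _ _ _) a i<g (inj₁ in-x) = inj₂ (inBand⁺ i<g in-x)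
  InCross-point⁺ (bands _ _ _ _) a i<g (inj₂ in-y) = inj₁ (inBand⁺ i<g in-y)

  point-injective : ∀ {a b i j} → i < g → j < g → point a i ≡ point b j → a ≡ b × i ≡ j
  point-injective {a} {b} {i} {j} i<g j<g eq =
    a≡b , ℕ.+-cancelˡ-≡ (xRank a * g) i j (trans x≡ (cong (λ c → xRank c * g + j) (sym a≡b)))
    where
    x≡ : xRank a * g + i ≡ xRank b * g + j
    x≡ = ℕ.suc-injective (toℚ-injective (cong proj₁ eq))
    a≡b : a ≡ b
    a≡b = Fin.toℕ-injective (ℕ.≤-antisym
      (*≤*+⇒≤ j<g (subst (xRank a * g ≤_) x≡ (ℕ.m≤m+n _ i)))
      (*≤*+⇒≤ i<g (subst (xRank b * g ≤_) (sym x≡) (ℕ.m≤m+n _ j))))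

  cluster : Fin 8 → List Point
  cluster a = map (point a) (upTo g)

  points : List Point
  points = concat (map cluster (allFin 8))

  length-cluster : ∀ a → length (cluster a) ≡ g
  length-cluster a = trans (length-map (point a) (upTo g)) (length-upTo g)

  cluster-unique : ∀ a → Unique (cluster a)
  cluster-unique a =
    Unique-map⁺ (λ i∈ j∈ → proj₂ ∘ point-injective {a} {a} (∈-upTo⁻ i∈) (∈-upTo⁻ j∈)) (Unique.upTo⁺ g)

  clusters-disjoint : ∀ {a b} → a ≢ b → Disjoint (cluster a) (cluster b)
  clusters-disjoint {a} {b} a≢b (p∈a , p∈b) with ∈-map⁻ (point a) p∈a | ∈-map⁻ (point b) p∈b
  ... | i , i∈ , refl | j , j∈ , eq = a≢b (proj₁ (point-injective (∈-upTo⁻ i∈) (∈-upTo⁻ j∈) eq))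

  points-unique : Unique points
  points-unique = Unique.concat⁺ clusters-unique clusters-disjoint′
    where
    clusters-unique : All Unique (map cluster (allFin 8))
    clusters-unique = All.map⁺ (All.universal cluster-unique (allFin 8))
    clusters-disjoint′ : AllPairs Disjoint (map cluster (allFin 8))
    clusters-disjoint′ = AllPairs.map⁺ (AllPairs.map (λ {a} {b} → clusters-disjoint {a} {b}) (Unique.allFin⁺ 8))

  ∈-points⁻ : ∀ {p} → p ∈ points → ∃ λ a → ∃ λ i → i < g × p ≡ point a i
  ∈-points⁻ p∈points with ∈-concat⁻′ (map cluster (allFin 8)) p∈points
  ... | _ , p∈cluster , cluster∈ with ∈-map⁻ cluster {xs = allFin 8} cluster∈
  ...   | a , _ , refl with ∈-map⁻ (point a) p∈cluster
  ...     | i , i∈ , p≡ = a , i , ∈-upTo⁻ i∈ , p≡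

  cluster⊆points : ∀ a → cluster a ⊆ points
  cluster⊆points a p∈cluster = ∈-concat⁺′ p∈cluster (∈-map⁺ cluster (∈-allFin a))

  cluster⊆edge : ∀ B a → Selects B a → cluster a ⊆ filter (inCross? (crossOf B)) points
  cluster⊆edge B a selected p∈cluster with ∈-map⁻ (point a) p∈cluster
  ... | i , i∈ , refl =
    ∈-filter⁺ (inCross? (crossOf B)) (cluster⊆points a p∈cluster) (InCross-point⁺ B a (∈-upTo⁻ i∈) selected)

  length-three-clusters : ∀ a b c → length (cluster a ++ cluster b ++ cluster c) ≡ 3 * g
  length-three-clusters a b c = begin-equality
    length (cluster a ++ cluster b ++ cluster c)         ≡⟨ length-++ (cluster a) ⟩
    length (cluster a) + length (cluster b ++ cluster c) ≡⟨ cong (length (cluster a) +_) (length-++ (cluster b)) ⟩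
    length (cluster a) + (length (cluster b) + length (cluster c))
      ≡⟨ cong₂ _+_ (length-cluster a) (cong₂ _+_ (length-cluster b) (length-cluster c)) ⟩
    g + (g + g)                                          ≡⟨ cong (λ n → g + (g + n)) (ℕ.*-identityˡ g) ⟨
    3 * g                                                ∎
    where open ℕ.≤-Reasoning

  edgeSize-three-clusters : ∀ {a b c} → Distinct a b c → 3 * g ≤ edgeSize points (crossOf (crossFor a b c))
  edgeSize-three-clusters {a} {b} {c} distinct@(a≢b , a≢c , b≢c) =
    subst (_≤ edgeSize points (crossOf B)) (length-three-clusters a b c) (Unique⇒length≤ three-unique three⊆edge)
    where
    B = crossFor a b c
    selected : ∀ d → OneOf a b c d → Selects B d
    selected d = proj₂ (crossFor-exact a b c distinct d)
    three-unique : Unique (cluster a ++ cluster b ++ cluster c)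
    three-unique = Unique.++⁺ (cluster-unique a) (Unique.++⁺ (cluster-unique b) (cluster-unique c) (clusters-disjoint b≢c))
      λ (p∈a , p∈bc) → Sum.[ (λ p∈b → clusters-disjoint a≢b (p∈a , p∈b)) , (λ p∈c → clusters-disjoint a≢c (p∈a , p∈c)) ]
                         (∈-++⁻ (cluster b) p∈bc)
    three⊆edge : cluster a ++ cluster b ++ cluster c ⊆ filter (inCross? (crossOf B)) points
    three⊆edge p∈ with ∈-++⁻ (cluster a) p∈
    ... | inj₁ p∈a = cluster⊆edge B a (selected a (inj₁ refl)) p∈a
    ... | inj₂ p∈bc with ∈-++⁻ (cluster b) p∈bc
    ...   | inj₁ p∈b = cluster⊆edge B b (selected b (inj₂ (inj₁ refl))) p∈b
    ...   | inj₂ p∈c = cluster⊆edge B c (selected c (inj₂ (inj₂ refl))) p∈c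

  edge-within-clusters : ∀ B {p} → p ∈ points → InCross (crossOf B) p → ∃ λ a → Selects B a × p ∈ cluster a
  edge-within-clusters B p∈points p-in with ∈-points⁻ p∈points
  ... | a , i , i<g , refl = a , InCross-point⁻ B a i<g p-in , ∈-map⁺ (point a) (∈-upTo⁺ i<g)

module Counting (g k : ℕ) (colour : Point → Fin k) where
  open Clusters g
  open DecMembership (Fin._≟_ {k}) using (_∈?_)

  colours : Fin 8 → List (Fin k)
  colours a = map colour (cluster a)

  missingFrom : Fin k → List (Fin 8)
  missingFrom j = filter (λ a → ¬? (j ∈? colours a)) (allFin 8)

  present absent : Fin 8 → Fin k → ℕ
  present a j = 𝟙 (j ∈? colours a)
  absent a j = 𝟙 (¬? (j ∈? colours a))

  ∑present≤g : ∀ a → ∑[ j < k ] present a j ≤ g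
  ∑present≤g a = begin
    ∑[ j < k ] present a j                      ≡⟨ length-filter-tabulate (_∈? colours a) id ⟨
    length (filter (_∈? colours a) (allFin k)) ≤⟨ Unique⇒length≤ (Unique.filter⁺ _ (Unique.allFin⁺ k)) present⊆ ⟩
    length (colours a)                          ≡⟨ trans (length-map colour (cluster a)) (length-cluster a) ⟩
    g                                           ∎
    where
    open ℕ.≤-Reasoning
    present⊆ : filter (_∈? colours a) (allFin k) ⊆ colours a
    present⊆ = proj₂ ∘ ∈-filter⁻ (_∈? colours a) {xs = allFin k}

  ∑present+∑absent≡k : ∀ a → ∑[ j < k ] present a j + ∑[ j < k ] absent a j ≡ k
  ∑present+∑absent≡k a = begin-equality
    ∑[ j < k ] present a j + ∑[ j < k ] absent a j ≡⟨ ∑-distrib-+ (present a) (absent a) ⟨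
    ∑[ j < k ] (present a j + absent a j)         ≡⟨ sum-cong-≗ (λ j → 𝟙+𝟙¬≡1 (j ∈? colours a)) ⟩
    ∑[ j < k ] 1                                  ≡⟨ sum-const k 1 ⟩
    k * 1                                         ≡⟨ ℕ.*-identityʳ k ⟩
    k                                             ∎
    where open ℕ.≤-Reasoning

  -- Count the pairs (cluster a, colour j) once by clusters, once by colours.
  double-count : 8 * k ≤ 8 * g + ∑[ j < k ] length (missingFrom j)
  double-count = begin
    8 * k                                     ≡⟨ sum-const 8 k ⟨
    ∑[ a < 8 ] k                              ≡⟨ sum-cong-≗ ∑present+∑absent≡k ⟨
    ∑[ a < 8 ] (∑[ j < k ] present a j + ∑[ j < k ] absent a j)
                                              ≡⟨ ∑-distrib-+ (λ a → ∑[ j < k ] present a j) (λ a → ∑[ j < k ] absent a j) ⟩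
    ∑[ a < 8 ] ∑[ j < k ] present a j + ∑[ a < 8 ] ∑[ j < k ] absent a j
                                              ≤⟨ ℕ.+-monoˡ-≤ _ (sum-mono-≤ ∑present≤g) ⟩
    ∑[ a < 8 ] g + ∑[ a < 8 ] ∑[ j < k ] absent a j
                                              ≡⟨ cong₂ _+_ (sum-const 8 g) (∑-comm absent) ⟩
    8 * g + ∑[ j < k ] ∑[ a < 8 ] absent a j ≡⟨ cong (8 * g +_) (sum-cong-≗ length-missingFrom) ⟨
    8 * g + ∑[ j < k ] length (missingFrom j) ∎
    where
    open ℕ.≤-Reasoning
    length-missingFrom : ∀ j → length (missingFrom j) ≡ ∑[ a < 8 ] absent a j
    length-missingFrom j = length-filter-tabulate (λ a → ¬? (j ∈? colours a)) id

  colour-missing-thrice : 4 * g < 3 * k → ∃ λ j → 3 ≤ length (missingFrom j)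
  colour-missing-thrice 4g<3k with Fin.any? (λ j → 3 ℕ.≤? length (missingFrom j))
  ... | yes found = found
  ... | no none = ⊥-elim (ℕ.<-irrefl refl (begin-strict
    8 * k                                     ≤⟨ double-count ⟩
    8 * g + ∑[ j < k ] length (missingFrom j) ≤⟨ ℕ.+-monoʳ-≤ (8 * g) (sum-mono-≤ at-most-twice) ⟩
    8 * g + ∑[ j < k ] 2                      ≡⟨ cong (8 * g +_) (trans (sum-const k 2) (ℕ.*-comm k 2)) ⟩
    8 * g + 2 * k                             <⟨ ℕ.+-monoˡ-< (2 * k) 8g<6k ⟩
    6 * k + 2 * k                             ≡⟨ ℕ.*-distribʳ-+ k 6 2 ⟨
    8 * k                                     ∎))
    where
    open ℕ.≤-Reasoning
    at-most-twice : ∀ j → length (missingFrom j) ≤ 2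
    at-most-twice j = ℕ.≤-pred (ℕ.≰⇒> (λ thrice → none (j , thrice)))
    8g<6k : 8 * g < 6 * k
    8g<6k = subst₂ _<_ (sym (ℕ.*-assoc 2 4 g)) (sym (ℕ.*-assoc 2 3 k)) (ℕ.*-monoʳ-< 2 4g<3k)

  three-clusters-missing : 4 * g < 3 * k →
    ∃ λ j → ∃ λ a → ∃ λ b → ∃ λ c → Distinct a b c × (∀ d → OneOf a b c d → j ∉ colours d)
  three-clusters-missing 4g<3k
    with j , thrice ← colour-missing-thrice 4g<3k
    with a , b , c , distinct , a∈ , b∈ , c∈ ←
           three-distinct (Unique.filter⁺ (λ a → ¬? (j ∈? colours a)) (Unique.allFin⁺ 8)) thrice
    = j , a , b , c , distinct , missing
    where
    missing-from : ∀ {d} → d ∈ missingFrom j → j ∉ colours d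
    missing-from = proj₂ ∘ ∈-filter⁻ (λ a → ¬? (j ∈? colours a)) {xs = allFin 8}
    missing : ∀ d → OneOf a b c d → j ∉ colours d
    missing d (inj₁ refl) = missing-from a∈
    missing d (inj₂ (inj₁ refl)) = missing-from b∈
    missing d (inj₂ (inj₂ refl)) = missing-from c∈

clusterHypergraph : ℕ → HypA⁺
clusterHypergraph g = record { V = points ; distinct = points-unique ; E = λ _ → ⊤ }
  where open Clusters g

not-polychromatic : ∀ g {k} → 4 * g < 3 * k → ¬ PolychromaticGE k (3 * g) (clusterHypergraph g)
not-polychromatic g {k} 4g<3k (colour , polychromatic) =
  let j , a , b , c , distinct , missing = three-clusters-missing 4g<3k
      p , p∈points , p-in , p-j = polychromatic (crossOf (crossFor a b c)) tt (edgeSize-three-clusters distinct) j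
      d , d-selected , p∈d = edge-within-clusters (crossFor a b c) p∈points p-in
  in missing d (proj₁ (crossFor-exact a b c distinct d) d-selected) (subst (_∈ colours d) p-j (∈-map⁺ colour p∈d))
  where
  open Clusters g
  open Counting g k colour

PolychromaticGE-mono : ∀ {k m m′} H → m ≤ m′ → PolychromaticGE k m H → PolychromaticGE k m′ H
PolychromaticGE-mono _ m≤m′ (colour , polychromatic) =
  colour , λ s e big → polychromatic s e (ℕ.≤-trans m≤m′ big)

not-good : ∀ g {k m} → 4 * g < 3 * k → m ≤ 3 * g → ¬ Good k m
not-good g 4g<3k m≤3g good =
  not-polychromatic g 4g<3k (PolychromaticGE-mono (clusterHypergraph g) m≤3g (good (clusterHypergraph g)))

ceil/4≡suc⇒4*< : ∀ a {g} → ceil/4 a ≡ suc g → 4 * g < a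
ceil/4≡suc⇒4*< a {g} eq = ℕ.+-cancelˡ-≤ 3 (suc (4 * g)) a (begin
  4 + 4 * g       ≡⟨ ℕ.*-suc 4 g ⟨
  4 * suc g       ≡⟨ ℕ.*-comm 4 (suc g) ⟩
  suc g * 4       ≡⟨ cong (_* 4) eq ⟨
  ceil/4 a * 4    ≤⟨ m/n*n≤m (a + 3) 4 ⟩
  a + 3           ≡⟨ ℕ.+-comm a 3 ⟩
  3 + a           ∎)
  where open ℕ.≤-Reasoning

lower-bound : ∀ k m → Good k m → 3 * ceil/4 (3 * k) ∸ 2 ≤ m
lower-bound k m good with ceil/4 (3 * k) in eq
... | zero = z≤n
... | suc g = begin
  3 * suc g ∸ 2 ≡⟨ cong (_∸ 2) (ℕ.*-suc 3 g) ⟩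
  suc (3 * g)   ≤⟨ ℕ.≮⇒≥ (λ m≤3g → not-good g (ceil/4≡suc⇒4*< (3 * k) eq) (ℕ.≤-pred m≤3g) good) ⟩
  m             ∎
  where open ℕ.≤-Reasoning

theorem4 : ∀ (k : ℕ) → 1 ≤ k →
    (∃ λ m → 1 ≤ m × m ≤ 4 * k ∸ 3 × Good k m)
    × (∀ m → 1 ≤ m → Good k m → 3 * ceil/4 (3 * k) ∸ 2 ≤ m)
theorem4 (suc k′) _ =
  (4 * suc k′ ∸ 3 , subst (1 ≤_) (sym (4k∸3≡ k′)) (s≤s z≤n) , ≤-refl , upper-bound k′) ,
  λ m _ → lower-bound (suc k′) m
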